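{- Let $\mathcal{X}$ be the class of finite groups $G$ with the property that a finite subset of $G$ is independent if and only if it is strongly independent. Then $\mathcal{X}$ is closed under taking subgroups, and every group in $\mathcal{X}$ is an EPPO group.
   Context: A subset $A$ of a group $G$ is independent if $a\notin\langle A\setminus\{a\}\rangle$ for every $a\in A$. A finite subset $A$ of $G$ is strongly independent if no subgroup of $G$ containing $A$ can be generated by fewer than $|A|$ elements. An EPPO group is a group in which every element has prime power order (the identity having order $1=p^0$). -}

module Defs where

open import Level using (Level; _⊔_; Lift) renaming (suc to lsuc)
open import Algebra.Bundles using (Group)
open import Algebra.Structures using (IsGroup; IsMonoid; IsSemigroup; IsMagma)
open import Data.Nat using (ℕ; zero; suc; _<_; _≤_; _^_)
open import Data.Nat.Primality using (Prime)
open import Data.Fin using (Fin)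
open import Data.Product using (Σ; ∃; _×_; _,_; proj₁; proj₂)
open import Relation.Nullary using (¬_)
open import Relation.Binary.PropositionalEquality using (_≡_)
open import Relation.Binary.Structures using (IsEquivalence)
open import Relation.Unary using (Pred)

module _ {c ℓ : Level} (G : Group c ℓ) where
  open Group G

  record IsFiniteGroup : Set (c ⊔ ℓ) where
    field
      size    : ℕ
      enum    : Fin size → Carrier
      index   : Carrier → Fin size
      index-cong : ∀ {x y} → x ≈ y → index x ≡ index y
      enum-index : ∀ x → enum (index x) ≈ x
      index-enum : ∀ i → index (enum i) ≡ i

  record Subgroup : Set (lsuc (c ⊔ ℓ)) where
    field
      P     : Pred Carrier (c ⊔ ℓ)
      resp  : ∀ {x y} → x ≈ y → P x → P y
      ε∈    : P ε
      ∙∈    : ∀ {x y} → P x → P y → P (x ∙ y)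
      ⁻¹∈   : ∀ {x} → P x → P (x ⁻¹)

  data ⟨_⟩ (S : Pred Carrier (c ⊔ ℓ)) : Pred Carrier (c ⊔ ℓ) where
    gen  : ∀ {x} → S x → ⟨ S ⟩ x
    one  : ⟨ S ⟩ ε
    mul  : ∀ {x y} → ⟨ S ⟩ x → ⟨ S ⟩ y → ⟨ S ⟩ (x ∙ y)
    inv  : ∀ {x} → ⟨ S ⟩ x → ⟨ S ⟩ (x ⁻¹)
    resp : ∀ {x y} → x ≈ y → ⟨ S ⟩ x → ⟨ S ⟩ y

  -- Finite subsets of G are given as injective families A : Fin k → G
  -- (so |A| = k).
  InjectiveFamily : {k : ℕ} → (Fin k → Carrier) → Set ℓ
  InjectiveFamily A = ∀ i j → A i ≈ A j → i ≡ j

  Without : {k : ℕ} → (Fin k → Carrier) → Fin k → Pred Carrier (c ⊔ ℓ)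
  Without A i x = Lift c (Σ _ λ j → (¬ j ≡ i) × (x ≈ A j))

  Range : {m : ℕ} → (Fin m → Carrier) → Pred Carrier (c ⊔ ℓ)
  Range g x = Lift c (Σ _ λ j → x ≈ g j)

  Independent : {k : ℕ} → (Fin k → Carrier) → Set (c ⊔ ℓ)
  Independent A = ∀ i → ¬ ⟨ Without A i ⟩ (A i)

  GeneratedBy : Subgroup → ℕ → Set (c ⊔ ℓ)
  GeneratedBy H m = Σ (Fin m → Carrier) λ g →
    ∀ x → (Subgroup.P H x → ⟨ Range g ⟩ x) × (⟨ Range g ⟩ x → Subgroup.P H x)

  StronglyIndependent : {k : ℕ} → (Fin k → Carrier) → Set (lsuc (c ⊔ ℓ))
  StronglyIndependent {k} A = ∀ (H : Subgroup) → (∀ i → Subgroup.P H (A i)) →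
    ∀ m → m < k → ¬ GeneratedBy H m

  IndepIffStronglyIndep : Set (lsuc (c ⊔ ℓ))
  IndepIffStronglyIndep = ∀ (k : ℕ) (A : Fin k → Carrier) → InjectiveFamily A →
    (Independent A → StronglyIndependent A) × (StronglyIndependent A → Independent A)

  record InX : Set (lsuc (c ⊔ ℓ)) where
    field
      finite : IsFiniteGroup
      indep⇔strong : IndepIffStronglyIndep

  pow : Carrier → ℕ → Carrier
  pow g zero = ε
  pow g (suc n) = g ∙ pow g n

  HasOrder : Carrier → ℕ → Set ℓ
  HasOrder g n = (1 ≤ n) × (pow g n ≈ ε) × (∀ m → 1 ≤ m → pow g m ≈ ε → n ≤ m)

  -- EPPO: every element has prime power order (p^0 = 1 allowed).
  EPPO : Set (c ⊔ ℓ)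
  EPPO = ∀ g → Σ ℕ λ p → Σ ℕ λ e → Prime p × HasOrder g (p ^ e)

  subgroupGroup : Subgroup → Group (c ⊔ ℓ) ℓ
  subgroupGroup H = record
    { Carrier = Σ Carrier P
    ; _≈_ = λ x y → proj₁ x ≈ proj₁ y
    ; _∙_ = λ x y → (proj₁ x ∙ proj₁ y) , ∙∈ (proj₂ x) (proj₂ y)
    ; ε = ε , ε∈
    ; _⁻¹ = λ x → (proj₁ x ⁻¹) , ⁻¹∈ (proj₂ x)
    ; isGroup = record
      { isMonoid = record
        { isSemigroup = record
          { isMagma = record
            { isEquivalence = record { refl = refl ; sym = sym ; trans = trans }
            ; ∙-cong = ∙-cong }
          ; assoc = λ x y z → assoc (proj₁ x) (proj₁ y) (proj₁ z) }
        ; identity = (λ x → identityˡ (proj₁ x)) , (λ x → identityʳ (proj₁ x)) }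
      ; inverse = (λ x → inverseˡ (proj₁ x)) , (λ x → inverseʳ (proj₁ x))
      ; ⁻¹-cong = ⁻¹-cong }
    }
    where open Subgroup H

{-# OPTIONS --safe #-}
-- A subgroup H and its ambient group G generate the same subgroups from subsets
-- of H, and a subgroup of H generated by m elements is a subgroup of G generated
-- by m elements; so independence in H is independence in G, and strong
-- independence in G gives strong independence in H.
--
-- If g had order n with distinct prime divisors p and q, then g^p ∉ ⟨g^q⟩ and
-- g^q ∉ ⟨g^p⟩ (compare exponents modulo n, then modulo q resp. p), so
-- {g^p, g^q} would be independent; yet it lies in the one-generated group ⟨g⟩,
-- so it is not strongly independent.
module Submission where

open import Defs
open import Level using (Level; _⊔_; Lift; lift)
open import Algebra.Bundles using (Group)
open import Data.Empty using (⊥; ⊥-elim)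
open import Data.Fin using (Fin; toℕ; punchIn; punchOut) renaming (zero to fzero; suc to fsuc)
import Data.Fin as Fin
open import Data.Fin.Properties using (punchIn-punchOut; pigeonhole)
open import Data.List using ([]; _∷_; length)
open import Data.List.Relation.Unary.All as All using (All; []; _∷_)
open import Data.List.Relation.Unary.Any using (here; there)
open import Data.List.Membership.Propositional using (_∈_)
open import Data.Nat
  using (ℕ; zero; suc; pred; _+_; _*_; _∸_; _^_; _<_; _≤_; _≤?_; _≟_; z≤n; s≤s; NonZero; >-nonZero)
open import Data.Nat.Properties
  using (anyUpTo?; suc-pred; ≤-refl; ≤-trans; <⇒≤; <⇒≱; ≮⇒≥; <-cmp; n<1+n; m∸n≤m; m<n⇒0<n∸m;
         m+[n∸m]≡n; *-suc; *-zeroʳ; *-identityʳ; *-assoc; *-distribˡ-+)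
open import Data.Nat.Induction using (<-wellFounded)
open import Data.Nat.DivMod using (_%_; _/_; m≡m%n+[m/n]*n; m%n<n; m∣n⇒o%n%m≡o%m)
open import Data.Nat.Divisibility using (_∣_; m∣m*n; m%n≡0⇒n∣m; n∣m⇒m%n≡0)
open import Data.Nat.ListAction using (product)
open import Data.Nat.ListAction.Properties using (∈⇒∣product)
open import Data.Nat.Primality using (Prime; prime[2]; ¬prime[1]; prime⇒irreducible; prime⇒nonZero)
open import Data.Nat.Primality.Factorisation using (factorise)
open import Data.Product using (Σ; ∃; ∃₂; _×_; _,_; proj₁; proj₂)
open import Data.Sum using (inj₁; inj₂)
open import Function using (_∘_)
open import Induction.WellFounded using (Acc; acc)
open import Relation.Binary using (tri<; tri≈; tri>)
open import Relation.Binary.PropositionalEquality as ≡ using (_≡_)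
open import Relation.Nullary using (¬_; Dec; yes; no; _×-dec_)
open import Relation.Unary using (Pred; _⊆_; Decidable)

prime∣prime⇒≡ : ∀ {p q} → Prime p → Prime q → p ∣ q → p ≡ q
prime∣prime⇒≡ pp pq p∣q with prime⇒irreducible pq p∣q
... | inj₁ ≡.refl = ⊥-elim (¬prime[1] pp)
... | inj₂ p≡q    = p≡q

∣-resp-≡mod : ∀ {d n a b} .{{_ : NonZero d}} .{{_ : NonZero n}} →
  d ∣ n → a % n ≡ b % n → d ∣ b → d ∣ a
∣-resp-≡mod {d} {n} {a} {b} d∣n a≡b d∣b = m%n≡0⇒n∣m a d (begin
  a % d       ≡⟨ m∣n⇒o%n%m≡o%m d n a d∣n ⟨
  a % n % d   ≡⟨ ≡.cong (_% d) a≡b ⟩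
  b % n % d   ≡⟨ m∣n⇒o%n%m≡o%m d n b d∣n ⟩
  b % d       ≡⟨ n∣m⇒m%n≡0 b d d∣b ⟩
  0           ∎)
  where open ≡.≡-Reasoning

product-all≡ : ∀ {p ps} → All (_≡ p) ps → product ps ≡ p ^ length ps
product-all≡ []             = ≡.refl
product-all≡ {p} (≡.refl ∷ qs) = ≡.cong (p *_) (product-all≡ qs)

uniquePrimeDivisor⇒primePower : ∀ n .{{_ : NonZero n}} →
  (∀ {p q} → Prime p → Prime q → p ∣ n → q ∣ n → p ≡ q) →
  ∃₂ λ p e → Prime p × n ≡ p ^ e
uniquePrimeDivisor⇒primePower n unique with factorise n
... | record { factors = [] ; isFactorisation = n≡1 } = 2 , 0 , prime[2] , n≡1
... | record { factors = p ∷ ps ; isFactorisation = n≡p*ps ; factorsPrime = pp ∷ pps } =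
  p , suc (length ps) , pp , ≡.trans n≡p*ps (≡.cong (p *_) (product-all≡ (All.tabulate q≡p)))
  where
  ∣n : ∀ {q} → q ∈ (p ∷ ps) → q ∣ n
  ∣n q∈ = ≡.subst (_ ∣_) (≡.sym n≡p*ps) (∈⇒∣product q∈)
  q≡p : ∀ {q} → q ∈ ps → q ≡ p
  q≡p q∈ps = unique (All.lookup pps q∈ps) pp (∣n (there q∈ps)) (∣n (here ≡.refl))

leastWitness : ∀ {p} {P : Pred ℕ p} → Decidable P → ∀ {m} → P m →
  ∃ λ n → P n × (∀ k → k < n → ¬ P k)
leastWitness {P = P} P? = go (<-wellFounded _)
  where
  go : ∀ {m} → Acc _<_ m → P m → ∃ λ n → P n × (∀ k → k < n → ¬ P k)
  go {m} (acc smaller) Pm with anyUpTo? P? m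
  ... | yes (k , k<m , Pk) = go (smaller k<m) Pk
  ... | no none            = m , Pm , λ k k<m Pk → none (k , k<m , Pk)

module _ {c ℓ : Level} (G : Group c ℓ) where
  open Group G

  ⟨⟩-least : {S : Pred Carrier (c ⊔ ℓ)} (K : Subgroup G) → S ⊆ Subgroup.P K → ⟨_⟩ G S ⊆ Subgroup.P K
  ⟨⟩-least K S⊆K (gen s)    = S⊆K s
  ⟨⟩-least K S⊆K one        = Subgroup.ε∈ K
  ⟨⟩-least K S⊆K (mul x y)  = Subgroup.∙∈ K (⟨⟩-least K S⊆K x) (⟨⟩-least K S⊆K y)
  ⟨⟩-least K S⊆K (inv x)    = Subgroup.⁻¹∈ K (⟨⟩-least K S⊆K x)
  ⟨⟩-least K S⊆K (resp e x) = Subgroup.resp K e (⟨⟩-least K S⊆K x)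

  generated : Pred Carrier (c ⊔ ℓ) → Subgroup G
  generated S = record { P = ⟨_⟩ G S ; resp = resp ; ε∈ = one ; ∙∈ = mul ; ⁻¹∈ = inv }

  ⟨⟩-mono : {S T : Pred Carrier (c ⊔ ℓ)} → S ⊆ T → ⟨_⟩ G S ⊆ ⟨_⟩ G T
  ⟨⟩-mono S⊆T = ⟨⟩-least (generated _) (gen ∘ S⊆T)

  generated-generatedBy : ∀ {m} (g : Fin m → Carrier) → GeneratedBy G (generated (Range G g)) m
  generated-generatedBy g = g , λ _ → (λ x∈ → x∈) , (λ x∈ → x∈)

  stronglyIndependent⇒independent : ∀ {k} (A : Fin k → Carrier) →
    StronglyIndependent G A → Independent G A
  stronglyIndependent⇒independent {suc k} A strong i Aᵢ∈⟨A∖Aᵢ⟩ =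
    strong (generated (Range G B)) A⊆⟨B⟩ k ≤-refl (generated-generatedBy B)
    where
    B : Fin k → Carrier
    B = A ∘ punchIn i
    A∖Aᵢ⊆B : Without G A i ⊆ Range G B
    A∖Aᵢ⊆B (lift (j , j≢i , x≈Aⱼ)) =
      lift (punchOut i≢j , trans x≈Aⱼ (reflexive (≡.cong A (≡.sym (punchIn-punchOut i≢j)))))
      where i≢j = j≢i ∘ ≡.sym
    A⊆⟨B⟩ : ∀ j → ⟨_⟩ G (Range G B) (A j)
    A⊆⟨B⟩ j with j Fin.≟ i
    ... | yes ≡.refl = ⟨⟩-mono A∖Aᵢ⊆B Aᵢ∈⟨A∖Aᵢ⟩
    ... | no j≢i     = gen (A∖Aᵢ⊆B (lift (j , j≢i , refl)))

module _ {c ℓ : Level} (G : Group c ℓ) (H : Subgroup G) where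
  open Group G
  open Subgroup H using (P)

  private
    Gₕ : Group (c ⊔ ℓ) ℓ
    Gₕ = subgroupGroup G H

  ⟨⟩-fromSubgroup : {S : Pred Carrier (c ⊔ ℓ)} {S′ : Pred (Σ Carrier P) (c ⊔ ℓ)} →
    (∀ {w} → S′ w → S (proj₁ w)) → ∀ {w} → ⟨_⟩ Gₕ S′ w → ⟨_⟩ G S (proj₁ w)
  ⟨⟩-fromSubgroup f (gen s)    = gen (f s)
  ⟨⟩-fromSubgroup f one        = one
  ⟨⟩-fromSubgroup f (mul x y)  = mul (⟨⟩-fromSubgroup f x) (⟨⟩-fromSubgroup f y)
  ⟨⟩-fromSubgroup f (inv x)    = inv (⟨⟩-fromSubgroup f x)
  ⟨⟩-fromSubgroup f (resp e x) = resp e (⟨⟩-fromSubgroup f x)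

  -- Equality in Gₕ ignores the membership proof, so `resp refl` may replace it.
  ⟨⟩-toSubgroup : {S : Pred Carrier (c ⊔ ℓ)} {S′ : Pred (Σ Carrier P) (c ⊔ ℓ)} →
    S ⊆ P → (∀ {w} → S (proj₁ w) → S′ w) →
    ∀ {z} (z∈H : P z) → ⟨_⟩ G S z → ⟨_⟩ Gₕ S′ (z , z∈H)
  ⟨⟩-toSubgroup S⊆H f z∈H (gen s)    = gen (f s)
  ⟨⟩-toSubgroup S⊆H f z∈H one        = resp refl one
  ⟨⟩-toSubgroup S⊆H f z∈H (mul x y)  =
    resp refl (mul (⟨⟩-toSubgroup S⊆H f (⟨⟩-least G H S⊆H x) x)
                   (⟨⟩-toSubgroup S⊆H f (⟨⟩-least G H S⊆H y) y))
  ⟨⟩-toSubgroup S⊆H f z∈H (inv x)    = resp refl (inv (⟨⟩-toSubgroup S⊆H f (⟨⟩-least G H S⊆H x) x))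
  ⟨⟩-toSubgroup S⊆H f z∈H (resp e x) = resp e (⟨⟩-toSubgroup S⊆H f (⟨⟩-least G H S⊆H x) x)

  Range⊆H : ∀ {m} (g : Fin m → Σ Carrier P) → Range G (proj₁ ∘ g) ⊆ P
  Range⊆H g (lift (j , z≈gⱼ)) = Subgroup.resp H (sym z≈gⱼ) (proj₂ (g j))

  embed : Subgroup Gₕ → Subgroup G
  embed K = record
    { P   = λ z → Σ (P z) λ z∈H → K.P (z , z∈H)
    ; resp = λ { e (x∈H , x∈K) → Subgroup.resp H e x∈H , K.resp e x∈K }
    ; ε∈  = Subgroup.ε∈ H , K.ε∈
    ; ∙∈  = λ { (x∈H , x∈K) (y∈H , y∈K) → Subgroup.∙∈ H x∈H y∈H , K.∙∈ x∈K y∈K }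
    ; ⁻¹∈ = λ { (x∈H , x∈K) → Subgroup.⁻¹∈ H x∈H , K.⁻¹∈ x∈K }
    }
    where module K = Subgroup K

  independent-embed : ∀ {k} (A : Fin k → Σ Carrier P) → Independent Gₕ A → Independent G (proj₁ ∘ A)
  independent-embed A indep i Aᵢ∈ =
    indep i (⟨⟩-toSubgroup (λ { (lift (j , _ , z≈)) → Range⊆H A (lift (j , z≈)) })
                           (λ { (lift x) → lift x }) (proj₂ (A i)) Aᵢ∈)

  generatedBy-embed : ∀ {m} (K : Subgroup Gₕ) → GeneratedBy Gₕ K m → GeneratedBy G (embed K) m
  generatedBy-embed K (g , K≡⟨g⟩) = proj₁ ∘ g , λ z → K⊆⟨g⟩ , ⟨g⟩⊆K
    where
    K⊆⟨g⟩ : Subgroup.P (embed K) ⊆ ⟨_⟩ G (Range G (proj₁ ∘ g))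
    K⊆⟨g⟩ (z∈H , z∈K) = ⟨⟩-fromSubgroup (λ { (lift x) → lift x }) (proj₁ (K≡⟨g⟩ (_ , z∈H)) z∈K)
    ⟨g⟩⊆K : ⟨_⟩ G (Range G (proj₁ ∘ g)) ⊆ Subgroup.P (embed K)
    ⟨g⟩⊆K z∈ = z∈H , proj₂ (K≡⟨g⟩ _) (⟨⟩-toSubgroup (Range⊆H g) (λ { (lift x) → lift x }) z∈H z∈)
      where z∈H = ⟨⟩-least G H (Range⊆H g) z∈

  indepIffStronglyIndep-subgroup : IndepIffStronglyIndep G → IndepIffStronglyIndep Gₕ
  indepIffStronglyIndep-subgroup indep⇔strong k A inj =
    indep⇒strong , stronglyIndependent⇒independent Gₕ A
    where
    indep⇒strong : Independent Gₕ A → StronglyIndependent Gₕ A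
    indep⇒strong indep K A⊆K m m<k K≡⟨g⟩ =
      proj₁ (indep⇔strong k (proj₁ ∘ A) inj) (independent-embed A indep)
        (embed K) (λ i → proj₂ (A i) , A⊆K i) m m<k (generatedBy-embed K K≡⟨g⟩)

module _ {c ℓ : Level} (G : Group c ℓ) where
  open Group G
  open import Algebra.Properties.Group G using (identityʳ-unique; inverseʳ-unique)
  open import Relation.Binary.Reasoning.Setoid setoid

  pow-+ : ∀ g m n → pow G g (m + n) ≈ pow G g m ∙ pow G g n
  pow-+ g zero    n = sym (identityˡ _)
  pow-+ g (suc m) n = trans (∙-congˡ (pow-+ g m n)) (sym (assoc _ _ _))

  pow-*-ε : ∀ {g n} → pow G g n ≈ ε → ∀ k → pow G g (k * n) ≈ ε
  pow-*-ε gⁿ≈ε zero    = refl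
  pow-*-ε {g} {n} gⁿ≈ε (suc k) = begin
    pow G g (n + k * n)            ≈⟨ pow-+ g n (k * n) ⟩
    pow G g n ∙ pow G g (k * n)    ≈⟨ ∙-cong gⁿ≈ε (pow-*-ε gⁿ≈ε k) ⟩
    ε ∙ ε                          ≈⟨ identityˡ ε ⟩
    ε                              ∎

  pow-% : ∀ {g n} .{{_ : NonZero n}} → pow G g n ≈ ε → ∀ m → pow G g m ≈ pow G g (m % n)
  pow-% {g} {n} gⁿ≈ε m = begin
    pow G g m                                 ≡⟨ ≡.cong (pow G g) (m≡m%n+[m/n]*n m n) ⟩
    pow G g (m % n + m / n * n)               ≈⟨ pow-+ g (m % n) (m / n * n) ⟩
    pow G g (m % n) ∙ pow G g (m / n * n)     ≈⟨ ∙-congˡ (pow-*-ε gⁿ≈ε (m / n)) ⟩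
    pow G g (m % n) ∙ ε                       ≈⟨ identityʳ _ ⟩
    pow G g (m % n)                           ∎

  pow-∸ : ∀ {g m n} → m ≤ n → pow G g m ≈ pow G g n → pow G g (n ∸ m) ≈ ε
  pow-∸ {g} {m} {n} m≤n gᵐ≈gⁿ = identityʳ-unique (pow G g m) _ (begin
    pow G g m ∙ pow G g (n ∸ m)    ≈⟨ pow-+ g m (n ∸ m) ⟨
    pow G g (m + (n ∸ m))          ≡⟨ ≡.cong (pow G g) (m+[n∸m]≡n m≤n) ⟩
    pow G g n                      ≈⟨ gᵐ≈gⁿ ⟨
    pow G g m                      ∎)

  pow-⁻¹ : ∀ {g n} → pow G g (suc n) ≈ ε → ∀ m → pow G g m ⁻¹ ≈ pow G g (m * n)
  pow-⁻¹ {g} {n} gⁿ⁺¹≈ε m = sym (inverseʳ-unique _ _ (begin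
    pow G g m ∙ pow G g (m * n)    ≈⟨ pow-+ g m (m * n) ⟨
    pow G g (m + m * n)            ≡⟨ ≡.cong (pow G g) (*-suc m n) ⟨
    pow G g (m * suc n)            ≈⟨ pow-*-ε gⁿ⁺¹≈ε m ⟩
    ε                              ∎))

  -- ⟨g^d⟩ described explicitly; it is closed under inverses because g^(n+1) = ε.
  powerSubgroup : ∀ {g n} → pow G g (suc n) ≈ ε → ℕ → Subgroup G
  powerSubgroup {g} {n} gⁿ⁺¹≈ε d = record
    { P    = λ z → Lift c (∃ λ k → z ≈ pow G g (d * k))
    ; resp = λ { z≈w (lift (k , z≈)) → lift (k , trans (sym z≈w) z≈) }
    ; ε∈   = lift (0 , reflexive (≡.cong (pow G g) (≡.sym (*-zeroʳ d))))
    ; ∙∈   = λ { (lift (k , x≈)) (lift (l , y≈)) → lift (k + l , (begin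
               _ ∙ _                               ≈⟨ ∙-cong x≈ y≈ ⟩
               pow G g (d * k) ∙ pow G g (d * l)   ≈⟨ pow-+ g (d * k) (d * l) ⟨
               pow G g (d * k + d * l)             ≡⟨ ≡.cong (pow G g) (*-distribˡ-+ d k l) ⟨
               pow G g (d * (k + l))               ∎)) }
    ; ⁻¹∈  = λ { (lift (k , x≈)) → lift (k * n , (begin
               _ ⁻¹                                ≈⟨ ⁻¹-cong x≈ ⟩
               pow G g (d * k) ⁻¹                  ≈⟨ pow-⁻¹ gⁿ⁺¹≈ε (d * k) ⟩
               pow G g (d * k * n)                 ≡⟨ ≡.cong (pow G g) (*-assoc d k n) ⟩
               pow G g (d * (k * n))               ∎)) }
    }

  singleton : Carrier → Pred Carrier (c ⊔ ℓ)
  singleton g = Range G (λ (_ : Fin 1) → g)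

  pow∈⟨⟩ : ∀ g n → ⟨_⟩ G (singleton g) (pow G g n)
  pow∈⟨⟩ g zero    = one
  pow∈⟨⟩ g (suc n) = mul (gen (lift (fzero , refl))) (pow∈⟨⟩ g n)

  module _ {g n} (order : HasOrder G g n) where
    private
      gⁿ≈ε    = proj₁ (proj₂ order)
      minimal = proj₂ (proj₂ order)
      instance
        n-nonZero : NonZero n
        n-nonZero = >-nonZero (proj₁ order)
      period : pow G g (suc (pred n)) ≈ ε
      period = trans (reflexive (≡.cong (pow G g) (suc-pred n))) gⁿ≈ε

    pow-distinct-below : ∀ {a b} → a < b → b < n → ¬ pow G g a ≈ pow G g b
    pow-distinct-below {a} {b} a<b b<n gᵃ≈gᵇ =
      <⇒≱ b<n (≤-trans (minimal (b ∸ a) (m<n⇒0<n∸m a<b) (pow-∸ (<⇒≤ a<b) gᵃ≈gᵇ)) (m∸n≤m b a))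

    pow-injective-below : ∀ {a b} → a < n → b < n → pow G g a ≈ pow G g b → a ≡ b
    pow-injective-below {a} {b} a<n b<n gᵃ≈gᵇ with <-cmp a b
    ... | tri< a<b _ _ = ⊥-elim (pow-distinct-below a<b b<n gᵃ≈gᵇ)
    ... | tri≈ _ a≡b _ = a≡b
    ... | tri> _ _ b<a = ⊥-elim (pow-distinct-below b<a a<n (sym gᵃ≈gᵇ))

    pow-≈⇒≡mod : ∀ a b → pow G g a ≈ pow G g b → a % n ≡ b % n
    pow-≈⇒≡mod a b gᵃ≈gᵇ = pow-injective-below (m%n<n a n) (m%n<n b n) (begin
      pow G g (a % n)   ≈⟨ pow-% gⁿ≈ε a ⟨
      pow G g a         ≈⟨ gᵃ≈gᵇ ⟩
      pow G g b         ≈⟨ pow-% gⁿ≈ε b ⟩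
      pow G g (b % n)   ∎)

    pow∈⟨pow⟩⇒∣ : ∀ {d a} .{{_ : NonZero d}} → d ∣ n → ⟨_⟩ G (singleton (pow G g d)) (pow G g a) → d ∣ a
    pow∈⟨pow⟩⇒∣ {d} {a} d∣n gᵃ∈ = exponent-∣ (⟨⟩-least G ⟨gᵈ⟩ gᵈ∈⟨gᵈ⟩ gᵃ∈)
      where
      ⟨gᵈ⟩ : Subgroup G
      ⟨gᵈ⟩ = powerSubgroup {n = pred n} period d
      gᵈ∈⟨gᵈ⟩ : singleton (pow G g d) ⊆ Subgroup.P ⟨gᵈ⟩
      gᵈ∈⟨gᵈ⟩ (lift (_ , z≈gᵈ)) =
        lift (1 , trans z≈gᵈ (reflexive (≡.cong (pow G g) (≡.sym (*-identityʳ d)))))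
      exponent-∣ : Subgroup.P ⟨gᵈ⟩ (pow G g a) → d ∣ a
      exponent-∣ (lift (k , gᵃ≈gᵈᵏ)) = ∣-resp-≡mod d∣n (pow-≈⇒≡mod a (d * k) gᵃ≈gᵈᵏ) (m∣m*n k)

module _ {c ℓ : Level} (G : Group c ℓ) (indep⇔strong : IndepIffStronglyIndep G) where
  open Group G

  pair : Carrier → Carrier → Fin 2 → Carrier
  pair x y fzero        = x
  pair x y (fsuc fzero) = y

  cyclic-noIndependentPair : ∀ {g x y} → ⟨_⟩ G (singleton G g) x → ⟨_⟩ G (singleton G g) y →
    ¬ ⟨_⟩ G (singleton G y) x → ¬ ⟨_⟩ G (singleton G x) y → ⊥
  cyclic-noIndependentPair {g} {x} {y} x∈⟨g⟩ y∈⟨g⟩ x∉⟨y⟩ y∉⟨x⟩ =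
    proj₁ (indep⇔strong 2 (pair x y) injective) independent
      (generated G (singleton G g)) pair⊆⟨g⟩ 1 (s≤s (s≤s z≤n)) (generated-generatedBy G (λ _ → g))
    where
    pair⊆⟨g⟩ : ∀ i → ⟨_⟩ G (singleton G g) (pair x y i)
    pair⊆⟨g⟩ fzero        = x∈⟨g⟩
    pair⊆⟨g⟩ (fsuc fzero) = y∈⟨g⟩
    without₀ : Without G (pair x y) fzero ⊆ singleton G y
    without₀ (lift (fzero , 0≢0 , _))       = ⊥-elim (0≢0 ≡.refl)
    without₀ (lift (fsuc fzero , _ , z≈y))  = lift (fzero , z≈y)
    without₁ : Without G (pair x y) (fsuc fzero) ⊆ singleton G x
    without₁ (lift (fzero , _ , z≈x))       = lift (fzero , z≈x)
    without₁ (lift (fsuc fzero , 1≢1 , _))  = ⊥-elim (1≢1 ≡.refl)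
    independent : Independent G (pair x y)
    independent fzero        = x∉⟨y⟩ ∘ ⟨⟩-mono G without₀
    independent (fsuc fzero) = y∉⟨x⟩ ∘ ⟨⟩-mono G without₁
    injective : InjectiveFamily G (pair x y)
    injective fzero        fzero        _   = ≡.refl
    injective fzero        (fsuc fzero) x≈y = ⊥-elim (x∉⟨y⟩ (gen (lift (fzero , x≈y))))
    injective (fsuc fzero) fzero        y≈x = ⊥-elim (y∉⟨x⟩ (gen (lift (fzero , y≈x))))
    injective (fsuc fzero) (fsuc fzero) _   = ≡.refl

  order-uniquePrimeDivisor : ∀ {g n} → HasOrder G g n →
    ∀ {p q} → Prime p → Prime q → p ∣ n → q ∣ n → p ≡ q
  order-uniquePrimeDivisor {g} {n} order {p} {q} pp pq p∣n q∣n with p ≟ q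
  ... | yes p≡q = p≡q
  ... | no p≢q  = ⊥-elim (cyclic-noIndependentPair (pow∈⟨⟩ G g p) (pow∈⟨⟩ G g q)
        (gᵃ∉⟨gᵇ⟩ pp pq p≢q q∣n) (gᵃ∉⟨gᵇ⟩ pq pp (p≢q ∘ ≡.sym) p∣n))
    where
    gᵃ∉⟨gᵇ⟩ : ∀ {a b} → Prime a → Prime b → ¬ a ≡ b → b ∣ n → ¬ ⟨_⟩ G (singleton G (pow G g b)) (pow G g a)
    gᵃ∉⟨gᵇ⟩ pa pb a≢b b∣n gᵃ∈ =
      a≢b (≡.sym (prime∣prime⇒≡ pb pa (pow∈⟨pow⟩⇒∣ G order {{prime⇒nonZero pb}} b∣n gᵃ∈)))

module _ {c ℓ : Level} (G : Group c ℓ) (finite : IsFiniteGroup G) where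
  open Group G
  open IsFiniteGroup finite

  index-injective : ∀ {x y} → index x ≡ index y → x ≈ y
  index-injective {x} {y} ix≡iy =
    trans (sym (enum-index x)) (trans (reflexive (≡.cong enum ix≡iy)) (enum-index y))

  ≈-dec : ∀ x y → Dec (x ≈ y)
  ≈-dec x y with index x Fin.≟ index y
  ... | yes ix≡iy = yes (index-injective ix≡iy)
  ... | no ix≢iy  = no (ix≢iy ∘ index-cong)

  -- Among the size + 1 powers g^0, …, g^size two coincide.
  pow-period : ∀ g → ∃ λ m → 1 ≤ m × pow G g m ≈ ε
  pow-period g with pigeonhole (n<1+n size) (λ i → index (pow G g (toℕ i)))
  ... | i , j , i<j , same = toℕ j ∸ toℕ i , m<n⇒0<n∸m i<j , pow-∸ G (<⇒≤ i<j) (index-injective same)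

  order : ∀ g → ∃ (HasOrder G g)
  order g with leastWitness (λ m → (1 ≤? m) ×-dec ≈-dec (pow G g m) ε) (proj₂ (pow-period g))
  ... | n , (1≤n , gⁿ≈ε) , below =
    n , 1≤n , gⁿ≈ε , λ m 1≤m gᵐ≈ε → ≮⇒≥ (λ m<n → below m m<n (1≤m , gᵐ≈ε))

eppo : ∀ {c ℓ} {G : Group c ℓ} → InX G → EPPO G
eppo {G = G} X g with order G (InX.finite X) g
... | n , hasOrder with uniquePrimeDivisor⇒primePower n {{>-nonZero (proj₁ hasOrder)}}
                          (order-uniquePrimeDivisor G (InX.indep⇔strong X) hasOrder)
...   | p , e , pp , n≡pᵉ = p , e , pp , ≡.subst (HasOrder G g) n≡pᵉ hasOrder

mainTheorem3 : ∀ {c ℓ : Level} (G : Group c ℓ) → InX G →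
    ((H : Subgroup G) → IndepIffStronglyIndep (subgroupGroup G H)) × EPPO G
mainTheorem3 G X = (λ H → indepIffStronglyIndep-subgroup G H (InX.indep⇔strong X)) , eppo X
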